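{- Let $n$ be a positive integer and $k$ an integer. Let $\sigma=\sigma_1\cdots\sigma_{3n}$ be the output of the right-to-left sweep map applied to a $(2n,n)$-Dyck path, and let $\tau=(\tau_1,\dots,\tau_{3n})$ be the corresponding rank sequence. Suppose that for some index $i$ we have $\sigma_i = \mathrm{W}$, $\tau_i = kn$, and $\sigma_{i+1}=\mathrm{S}$. Then $\tau_{i+1}=kn$. Moreover, if in addition $\sigma_{i+2}=\mathrm{S}$, then $\tau_{i+2}=kn$ as well.
   Context: A $(2n,n)$-Dyck path is a sequence of $3n$ steps, $n$ of which are north steps and $2n$ of which are east steps, together with the following levels. Each lattice point of the path has a level: the starting point has level $0$, a north step raises the level by $2n$, an east step lowers the level by $n$. The path is required never to reach a negative level, so it begins and ends at level $0$. The level of a north step is the level of its starting point, called its south endpoint, labelled S. The level of an east step is the level of its starting point, called its west endpoint, labelled W. The right-to-left sweep map lists the $3n$ steps in nondecreasing order of level. Among steps of equal level, the step occurring later in the path is listed first. The output is the word $\sigma=\sigma_1\cdots\sigma_{3n}$ recording S for a north step and W for an east step. For each $j$, $\tau_j$ is the level of the step listed in position $j$. Thus $\tau$ is the rank sequence of the path, nondecreasing and aligned with $\sigma$. -}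

module Defs where

open import Data.Nat using (ℕ; zero; suc)
open import Data.Integer using (ℤ; +_; _+_; _-_; _≤_; _<_; _<?_; _≟_)
import Data.Nat as ℕ
open import Data.Bool using (Bool; true; false; _∨_; _∧_)
open import Data.List using (List; []; _∷_; map; length; filter)
open import Data.List.Relation.Unary.All using (All)
open import Data.Maybe using (Maybe; just; nothing)
open import Data.Product using (_×_; _,_; proj₁; proj₂)
open import Relation.Binary.PropositionalEquality using (_≡_)
open import Relation.Nullary.Decidable using (⌊_⌋)

data Step : Set where
  N E : Step

-- Letters of the sweep-map output word: S (south endpoint of a north step),
-- W (west endpoint of an east step).
data Letter : Set where
  S W : Letter

letter : Step → Letter
letter N = S
letter E = W

δ : ℕ → Step → ℤ
δ n N = + (2 ℕ.* n)
δ n E = (+ 0) - (+ n)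

pointLevels : ℕ → ℤ → List Step → List ℤ
pointLevels n ℓ []       = ℓ ∷ []
pointLevels n ℓ (s ∷ p)  = ℓ ∷ pointLevels n (ℓ + δ n s) p

countN : List Step → ℕ
countN []      = 0
countN (N ∷ p) = suc (countN p)
countN (E ∷ p) = countN p

countE : List Step → ℕ
countE []      = 0
countE (N ∷ p) = countE p
countE (E ∷ p) = suc (countE p)

record IsDyck (n : ℕ) (p : List Step) : Set where
  field
    northCount : countN p ≡ n
    eastCount  : countE p ≡ 2 ℕ.* n
    nonneg     : All (λ ℓ → + 0 ≤ ℓ) (pointLevels n (+ 0) p)

-- each step annotated with (letter, level of its starting point, position in path)
annotate : ℕ → ℤ → ℕ → List Step → List (Letter × ℤ × ℕ)
annotate n ℓ i []      = []
annotate n ℓ i (s ∷ p) = (letter s , ℓ , i) ∷ annotate n (ℓ + δ n s) (suc i) p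

before : Letter × ℤ × ℕ → Letter × ℤ × ℕ → Bool
before (_ , ℓ , i) (_ , m , j) = ⌊ ℓ <? m ⌋ ∨ (⌊ ℓ ≟ m ⌋ ∧ ⌊ j ℕ.<? i ⌋)

insert : Letter × ℤ × ℕ → List (Letter × ℤ × ℕ) → List (Letter × ℤ × ℕ)
insert x []       = x ∷ []
insert x (y ∷ ys) with before x y
... | true  = x ∷ y ∷ ys
... | false = y ∷ insert x ys

sortSteps : List (Letter × ℤ × ℕ) → List (Letter × ℤ × ℕ)
sortSteps []       = []
sortSteps (x ∷ xs) = insert x (sortSteps xs)

sweepList : ℕ → List Step → List (Letter × ℤ × ℕ)
sweepList n p = sortSteps (annotate n (+ 0) 0 p)

sweep : ℕ → List Step → List Letter
sweep n p = map proj₁ (sweepList n p)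

rank : ℕ → List Step → List ℤ
rank n p = map (λ x → proj₁ (proj₂ x)) (sweepList n p)

-- 0-based list indexing
at : {A : Set} → List A → ℕ → Maybe A
at []       _       = nothing
at (x ∷ xs) zero    = just x
at (x ∷ xs) (suc i) = at xs i

-- A north step at level ℓ > 0 lifts the path to ℓ + 2n.  Every later level lies in
-- ℓ + nℕ, the steps change it by −n or +2n, and the path ends at 0 < ℓ, so some later
-- step starts at level exactly ℓ; the sweep lists that step before the north step.
-- Hence in the sweep order an S is never directly preceded by a step of strictly lower
-- level, and since the order is nondecreasing in level, an S has the level of its
-- predecessor.  Applied at positions i+1 and i+2 this is the theorem.
module Submission where

open import Defs
open import Data.Nat using (ℕ; suc; zero; NonZero)
import Data.Nat as ℕ
import Data.Nat.Properties as ℕ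
open import Data.Integer using (ℤ; +_; _*_; _+_; _-_; _≤_; _<_; _<?_; _≟_)
open import Data.Integer.Properties
open import Data.Integer.Tactic.RingSolver using (solve-∀)
open import Data.List using (List; []; _∷_; map)
open import Data.List.Relation.Unary.All as All using (All; _∷_)
open import Data.List.Relation.Unary.AllPairs using (AllPairs; []; _∷_)
open import Data.List.Relation.Unary.Any using (here; there)
open import Data.List.Membership.Propositional using (_∈_)
open import Data.List.Relation.Binary.Permutation.Propositional using (_↭_; refl; prep; swap; trans; ↭-sym)
open import Data.List.Relation.Binary.Permutation.Propositional.Properties using (∈-resp-↭; All-resp-↭)
open import Data.Bool using (true; false)
open import Data.Maybe using (just)
open import Data.Product using (_×_; _,_; proj₁; proj₂; ∃-syntax)
open import Data.Empty using (⊥; ⊥-elim)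
open import Relation.Nullary using (yes; no; ¬_)
open import Relation.Binary.PropositionalEquality
  using (_≡_; refl; sym; cong; subst; module ≡-Reasoning)
  renaming (trans to ≡-trans)

at-map⁻ : {A C : Set} (f : A → C) {l : List A} {i : ℕ} {v : C} →
  at (map f l) i ≡ just v → ∃[ e ] at l i ≡ just e × f e ≡ v
at-map⁻ f {x ∷ l} {zero}  refl = x , refl , refl
at-map⁻ f {x ∷ l} {suc i} eq   = at-map⁻ f {l} {i} eq

at-map⁺ : {A C : Set} (f : A → C) {l : List A} {i : ℕ} {e : A} →
  at l i ≡ just e → at (map f l) i ≡ just (f e)
at-map⁺ f {x ∷ l} {zero}  refl = refl
at-map⁺ f {x ∷ l} {suc i} eq   = at-map⁺ f {l} {i} eq

at-∈ : {A : Set} {l : List A} {i : ℕ} {e : A} → at l i ≡ just e → e ∈ l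
at-∈ {l = x ∷ l} {zero}  refl = here refl
at-∈ {l = x ∷ l} {suc i} eq   = there (at-∈ {l = l} {i} eq)

module SortedAdjacency {A : Set} (_≺_ : A → A → Set) (≺-irrefl : ∀ {a} → ¬ a ≺ a) where

  Sorted : List A → Set
  Sorted = AllPairs (λ a b → ¬ b ≺ a)

  adjacent-¬≻ : ∀ {L i x y} → Sorted L → at L i ≡ just x → at L (suc i) ≡ just y → ¬ y ≺ x
  adjacent-¬≻ {a ∷ b ∷ L} {zero}  (a⊀ ∷ _) refl refl = All.lookup a⊀ (here refl)
  adjacent-¬≻ {a ∷ L}     {suc i} (_ ∷ s)  ex   ey   = adjacent-¬≻ s ex ey

  adjacent-nothing-between : ∀ {L i x y z} → Sorted L →
    at L i ≡ just x → at L (suc i) ≡ just y → z ∈ L → x ≺ z → z ≺ y → ⊥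
  adjacent-nothing-between {a ∷ b ∷ L} {zero} _ refl refl (here refl) x≺z _ = ≺-irrefl x≺z
  adjacent-nothing-between {a ∷ b ∷ L} {zero} _ refl refl (there (here refl)) _ z≺y = ≺-irrefl z≺y
  adjacent-nothing-between {a ∷ b ∷ L} {zero} (_ ∷ b⊀ ∷ _) refl refl (there (there z∈)) _ z≺y =
    All.lookup b⊀ z∈ z≺y
  adjacent-nothing-between {a ∷ L} {suc i} (a⊀ ∷ _) ex _ (here refl) x≺z _ = All.lookup a⊀ (at-∈ ex) x≺z
  adjacent-nothing-between {a ∷ L} {suc i} (_ ∷ s) ex ey (there z∈) x≺z z≺y =
    adjacent-nothing-between s ex ey z∈ x≺z z≺y

Entry : Set
Entry = Letter × ℤ × ℕ

level : Entry → ℤ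
level e = proj₁ (proj₂ e)

position : Entry → ℕ
position e = proj₂ (proj₂ e)

infix 4 _≺_

data _≺_ (a b : Entry) : Set where
  level<           : level a < level b → a ≺ b
  same-level-later : level a ≡ level b → position b ℕ.< position a → a ≺ b

≺-irrefl : ∀ {a} → ¬ a ≺ a
≺-irrefl (level< l<l)             = <-irrefl refl l<l
≺-irrefl (same-level-later _ j<j) = ℕ.<-irrefl refl j<j

≺-trans : ∀ {a b c} → a ≺ b → b ≺ c → a ≺ c
≺-trans (level< p)                 (level< q)                 = level< (<-trans p q)
≺-trans (level< p)                 (same-level-later refl _)  = level< p
≺-trans (same-level-later refl _)  (level< q)                 = level< q
≺-trans (same-level-later refl p)  (same-level-later refl q)  = same-level-later refl (ℕ.<-trans q p)

before-true⇒≺ : ∀ a b → before a b ≡ true → a ≺ b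
before-true⇒≺ (_ , ℓ , i) (_ , m , j) eq with ℓ <? m | ℓ ≟ m | j ℕ.<? i
... | yes ℓ<m | _       | _       = level< ℓ<m
... | no _    | yes ℓ≡m | yes j<i = same-level-later ℓ≡m j<i
... | no _    | no _    | _       with () ← eq
... | no _    | yes _   | no _    with () ← eq

≺⇒before-true : ∀ a b → a ≺ b → before a b ≡ true
≺⇒before-true (_ , ℓ , i) (_ , m , j) a≺b with ℓ <? m | ℓ ≟ m | j ℕ.<? i | a≺b
... | yes _   | _      | _      | _                      = refl
... | no _    | yes _  | yes _  | _                      = refl
... | no ℓ≮m  | _      | _      | level< ℓ<m             = ⊥-elim (ℓ≮m ℓ<m)
... | no _    | no ℓ≢m | _      | same-level-later ℓ≡m _ = ⊥-elim (ℓ≢m ℓ≡m)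
... | no _    | yes _  | no j≮i | same-level-later _ j<i = ⊥-elim (j≮i j<i)

open SortedAdjacency _≺_ ≺-irrefl

insert-↭ : ∀ x ys → x ∷ ys ↭ insert x ys
insert-↭ x []       = refl
insert-↭ x (y ∷ ys) with before x y
... | true  = refl
... | false = trans (swap x y refl) (prep y (insert-↭ x ys))

sortSteps-↭ : ∀ xs → xs ↭ sortSteps xs
sortSteps-↭ []       = refl
sortSteps-↭ (x ∷ xs) = trans (prep x (sortSteps-↭ xs)) (insert-↭ x (sortSteps xs))

insert-sorted : ∀ x ys → Sorted ys → Sorted (insert x ys)
insert-sorted x []       []         = All.[] ∷ []
insert-sorted x (y ∷ ys) (y⊀ ∷ s) with before x y in eq
... | true  = x⊀ ∷ y⊀ ∷ s
  where
  x≺y : x ≺ y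
  x≺y = before-true⇒≺ x y eq
  x⊀ : All (λ w → ¬ w ≺ x) (y ∷ ys)
  x⊀ = (λ y≺x → ≺-irrefl (≺-trans x≺y y≺x))
     ∷ All.map (λ w⊀y w≺x → w⊀y (≺-trans w≺x x≺y)) y⊀
... | false = All-resp-↭ (insert-↭ x ys) (x⊀y ∷ y⊀) ∷ insert-sorted x ys s
  where
  x⊀y : ¬ x ≺ y
  x⊀y x≺y with () ← ≡-trans (sym eq) (≺⇒before-true x y x≺y)

sortSteps-sorted : ∀ xs → Sorted (sortSteps xs)
sortSteps-sorted []       = []
sortSteps-sorted (x ∷ xs) = insert-sorted x (sortSteps xs) (sortSteps-sorted xs)

endLevel : ℕ → ℤ → List Step → ℤ
endLevel n ℓ []      = ℓ
endLevel n ℓ (s ∷ p) = endLevel n (ℓ + δ n s) p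

endLevel-displacement : ∀ n a p →
  endLevel n a p ≡ a + + (2 ℕ.* n ℕ.* countN p) - + (n ℕ.* countE p)
endLevel-displacement n a [] rewrite ℕ.*-zeroʳ (2 ℕ.* n) | ℕ.*-zeroʳ n =
  no-displacement a
  where
  no-displacement : ∀ a → a ≡ a + + 0 - + 0
  no-displacement = solve-∀
endLevel-displacement n a (N ∷ p) = begin
  endLevel n (a + + 2n) p                    ≡⟨ endLevel-displacement n (a + + 2n) p ⟩
  a + + 2n + + (2n ℕ.* c) - + (n ℕ.* e)      ≡⟨ regroup a (+ 2n) (+ (2n ℕ.* c)) (+ (n ℕ.* e)) ⟩
  a + (+ 2n + + (2n ℕ.* c)) - + (n ℕ.* e)    ≡⟨ cong (λ q → a + q - + (n ℕ.* e)) (sym (pos-+ 2n (2n ℕ.* c))) ⟩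
  a + + (2n ℕ.+ 2n ℕ.* c) - + (n ℕ.* e)      ≡⟨ cong (λ q → a + + q - + (n ℕ.* e)) (sym (ℕ.*-suc 2n c)) ⟩
  a + + (2n ℕ.* suc c) - + (n ℕ.* e)         ∎
  where
  open ≡-Reasoning
  2n c e : ℕ
  2n = 2 ℕ.* n
  c = countN p
  e = countE p
  regroup : ∀ a x y z → a + x + y - z ≡ a + (x + y) - z
  regroup = solve-∀
endLevel-displacement n a (E ∷ p) = begin
  endLevel n (a + (+ 0 - + n)) p                   ≡⟨ endLevel-displacement n (a + (+ 0 - + n)) p ⟩
  a + (+ 0 - + n) + + (2 ℕ.* n ℕ.* c) - + (n ℕ.* e) ≡⟨ regroup a (+ n) (+ (2 ℕ.* n ℕ.* c)) (+ (n ℕ.* e)) ⟩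
  a + + (2 ℕ.* n ℕ.* c) - (+ n + + (n ℕ.* e))      ≡⟨ cong (λ q → a + + (2 ℕ.* n ℕ.* c) - q) (sym (pos-+ n (n ℕ.* e))) ⟩
  a + + (2 ℕ.* n ℕ.* c) - + (n ℕ.+ n ℕ.* e)        ≡⟨ cong (λ q → a + + (2 ℕ.* n ℕ.* c) - + q) (sym (ℕ.*-suc n e)) ⟩
  a + + (2 ℕ.* n ℕ.* c) - + (n ℕ.* suc e)          ∎
  where
  open ≡-Reasoning
  c e : ℕ
  c = countN p
  e = countE p
  regroup : ∀ a x y z → a + (+ 0 - x) + y - z ≡ a + y - (x + z)
  regroup = solve-∀

dyck-endLevel : ∀ {n p} → IsDyck n p → endLevel n (+ 0) p ≡ + 0
dyck-endLevel {n} {p} d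
  rewrite endLevel-displacement n (+ 0) p | IsDyck.northCount d | IsDyck.eastCount d
        | ℕ.*-comm (2 ℕ.* n) n
  = ≡-trans (cong (_- 2n²) (+-identityˡ 2n²)) (+-inverseʳ 2n²)
  where
  2n² : ℤ
  2n² = + (n ℕ.* (2 ℕ.* n))

annotate-position : ∀ {n a i z} p → z ∈ annotate n a i p → i ℕ.≤ position z
annotate-position (s ∷ p) (here refl) = ℕ.≤-refl
annotate-position (s ∷ p) (there z∈) = ℕ.<⇒≤ (annotate-position p z∈)

annotate-level-All : ∀ {n a i z} {P : ℤ → Set} p →
  All P (pointLevels n a p) → z ∈ annotate n a i p → P (level z)
annotate-level-All (s ∷ p) (Pa ∷ _)  (here refl) = Pa
annotate-level-All (s ∷ p) (_ ∷ Ps) (there z∈) = annotate-level-All p Ps z∈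

level-after-E : ∀ n m t {a} → a ≡ m + + (suc t ℕ.* n) → a + δ n E ≡ m + + (t ℕ.* n)
level-after-E n m t {a} a≡ = begin
  a + (+ 0 - + n)                       ≡⟨ cong (_+ (+ 0 - + n)) a≡ ⟩
  m + + (n ℕ.+ t ℕ.* n) + (+ 0 - + n)   ≡⟨ cong (λ q → m + q + (+ 0 - + n)) (pos-+ n (t ℕ.* n)) ⟩
  m + (+ n + + (t ℕ.* n)) + (+ 0 - + n) ≡⟨ cancel m (+ n) (+ (t ℕ.* n)) ⟩
  m + + (t ℕ.* n)                       ∎
  where
  open ≡-Reasoning
  cancel : ∀ m x y → m + (x + y) + (+ 0 - x) ≡ m + y
  cancel = solve-∀

level-after-N : ∀ n m t {a} → a ≡ m + + (t ℕ.* n) → a + δ n N ≡ m + + ((t ℕ.+ 2) ℕ.* n)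
level-after-N n m t {a} a≡ = begin
  a + + (2 ℕ.* n)                   ≡⟨ cong (_+ + (2 ℕ.* n)) a≡ ⟩
  m + + (t ℕ.* n) + + (2 ℕ.* n)     ≡⟨ +-assoc m _ _ ⟩
  m + (+ (t ℕ.* n) + + (2 ℕ.* n))   ≡⟨ cong (λ q → m + q) (sym (pos-+ (t ℕ.* n) (2 ℕ.* n))) ⟩
  m + + (t ℕ.* n ℕ.+ 2 ℕ.* n)       ≡⟨ cong (λ q → m + + q) (sym (ℕ.*-distribʳ-+ n t 2)) ⟩
  m + + ((t ℕ.+ 2) ℕ.* n)           ∎
  where open ≡-Reasoning

-- A step from level m + (t+1)n moves to m + tn or m + (t+3)n, so it cannot jump over m.
reaches-level : ∀ n m t {a} p i → a ≡ m + + (t ℕ.* n) → endLevel n a p < m →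
  ∃[ z ] z ∈ annotate n a i p × level z ≡ m
reaches-level n m t [] i a≡ end<m =
  ⊥-elim (<⇒≱ end<m (subst (m ≤_) (sym a≡) (i≤i+j m (+ (t ℕ.* n)))))
reaches-level n m zero {a} (s ∷ p) i a≡ _ = (letter s , a , i) , here refl , ≡-trans a≡ (+-identityʳ m)
reaches-level n m (suc t) (E ∷ p) i a≡ end<m
  with z , z∈ , lz ← reaches-level n m t p (suc i) (level-after-E n m t a≡) end<m = z , there z∈ , lz
reaches-level n m (suc t) (N ∷ p) i a≡ end<m
  with z , z∈ , lz ← reaches-level n m (suc t ℕ.+ 2) p (suc i) (level-after-N n m (suc t) a≡) end<m =
  z , there z∈ , lz

north-level-revisited : ∀ {n a i ℓ j} p → (S , ℓ , j) ∈ annotate n a i p → endLevel n a p < ℓ →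
  ∃[ z ] z ∈ annotate n a i p × level z ≡ ℓ × j ℕ.< position z
north-level-revisited {n} {a} {i} (N ∷ p) (here refl) end<ℓ
  with z , z∈ , lz ← reaches-level n a 2 p (suc i) refl end<ℓ =
  z , there z∈ , lz , annotate-position p z∈
north-level-revisited (E ∷ p) (here ())
north-level-revisited (s ∷ p) (there y∈) end<ℓ
  with z , z∈ , lz , j<z ← north-level-revisited p y∈ end<ℓ = z , there z∈ , lz , j<z

sweepList-S-level : ∀ {n p j x ℓ j′} → IsDyck n p →
  at (sweepList n p) j ≡ just x → at (sweepList n p) (suc j) ≡ just (S , ℓ , j′) → ℓ ≡ level x
sweepList-S-level {n} {p} {j} {x} {ℓ} {j′} d x-at y-at =
  ≤-antisym (≮⇒≥ x≮ℓ) (≮⇒≥ (λ ℓ<x → adjacent-¬≻ sorted x-at y-at (level< ℓ<x)))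
  where
  steps : List Entry
  steps = annotate n (+ 0) 0 p
  sorted : Sorted (sweepList n p)
  sorted = sortSteps-sorted steps

  y∈ : (S , ℓ , j′) ∈ steps
  y∈ = ∈-resp-↭ (↭-sym (sortSteps-↭ steps)) (at-∈ y-at)
  x≥0 : + 0 ≤ level x
  x≥0 = annotate-level-All p (IsDyck.nonneg d) (∈-resp-↭ (↭-sym (sortSteps-↭ steps)) (at-∈ x-at))

  end<ℓ : level x < ℓ → endLevel n (+ 0) p < ℓ
  end<ℓ x<ℓ = subst (_< ℓ) (sym (dyck-endLevel d)) (≤-<-trans x≥0 x<ℓ)

  x≮ℓ : ¬ level x < ℓ
  x≮ℓ x<ℓ with z , z∈ , lz , j′<z ← north-level-revisited p y∈ (end<ℓ x<ℓ) =
    adjacent-nothing-between sorted x-at y-at (∈-resp-↭ (sortSteps-↭ steps) z∈)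
      (level< (subst (level x <_) (sym lz) x<ℓ)) (same-level-later lz j′<z)

rank-after-S : ∀ {n p j r} → IsDyck n p →
  at (rank n p) j ≡ just r → at (sweep n p) (suc j) ≡ just S → at (rank n p) (suc j) ≡ just r
rank-after-S {n} {p} d r-at s-at
  with x , x-at , refl ← at-map⁻ level {sweepList n p} r-at
     | (_ , ℓ , j′) , y-at , refl ← at-map⁻ proj₁ {sweepList n p} s-at
  = ≡-trans (at-map⁺ level {sweepList n p} y-at) (cong just (sweepList-S-level d x-at y-at))

theorem3p2 : (n : ℕ) → NonZero n → (k : ℤ) → (p : List Step) → IsDyck n p →
    (i : ℕ) →
    at (sweep n p) i ≡ just W →
    at (rank n p) i ≡ just (k * + n) →
    at (sweep n p) (suc i) ≡ just S →
    at (rank n p) (suc i) ≡ just (k * + n)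
      × (at (sweep n p) (suc (suc i)) ≡ just S →
         at (rank n p) (suc (suc i)) ≡ just (k * + n))
theorem3p2 n _ k p d i _ rank-i sweep-i+1 = rank-i+1 , rank-after-S d rank-i+1
  where
  rank-i+1 : at (rank n p) (suc i) ≡ just (k * + n)
  rank-i+1 = rank-after-S d rank-i sweep-i+1
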